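{- Let $C$ be a single-sorted $<\kappa$-ary clone and $(d,(e_s)_{s\in S})$ an $S$-ary diagonal pair of $C$. Then $C$ is isomorphic to the matrix product $\boxtimes_{s\in S}e_s(C)$.
   Context: $S$ is a nonzero cardinal and $\kappa>S$ an infinite cardinal; cardinals are sets of smaller ordinals. A single-sorted $<\kappa$-ary clone $C$ consists of sets $C_\lambda$ ($\lambda<\kappa$ a cardinal; any set of size $<\kappa$ may be used as an arity via a fixed bijection), projections $\pi_{(\lambda,i)}\in C_\lambda$ ($i\in\lambda$), and compositions $C_{\lambda_1}\times C_{\lambda_2}^{\lambda_1}\to C_{\lambda_2}$, $(f,(g_i)_i)\mapsto f\circ(g_i)_i$, that are associative and satisfy $\pi_{(\lambda_1,i_0)}\circ(g_i)_i=g_{i_0}$, $f\circ(\pi_{(\lambda,i)})_i=f$; clone isomorphisms are sortwise bijections preserving projections and composition. An $S$-ary diagonal pair of $C$ is $(d,(e_s)_{s\in S})$ with $d\in C_S$, $e_s\in C_1$ such that (1) $e_s\circ d=e_s\circ\pi_{(S,s)}$ for all $s$; (2) $d\circ(e_s\circ\pi_{(S,s)})_{s\in S}=d$; (3) $d\circ(\pi_{(S,0)})_{s\in S}=\pi_{(S,0)}$. For a family $(e_s)_{s\in S}$ of idempotents of $C_1$ ($e_s\circ e_s=e_s$; the $e_s$ of a diagonal pair are idempotent), the matrix product $\boxtimes_{s\in S}e_s(C)$ is the single-sorted $<\kappa$-ary clone whose sort $\lambda$ is the set of tuples $(f_s/\sim_\lambda)_{s\in S}$ with $f_s\in C_{\lambda\times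 S}$ and $e_s\circ f_s=f_s$, where $f\sim_\lambda g$ iff $f\circ(e_t\circ\pi_{(\lambda\times S,(i,t))})_{(i,t)\in\lambda\times S}=g\circ(e_t\circ\pi_{(\lambda\times S,(i,t))})_{(i,t)\in\lambda\times S}$; projections $\pi_{(\lambda,i)}=(e_s\circ\pi_{(\lambda\times S,(i,s))}/\sim_\lambda)_{s\in S}$; composition $(f_s/\sim)_s\circ((g_{i,t}/\sim)_t)_{i\in\lambda_1}=(f_s\circ(g_{i,t})_{(i,t)\in\lambda_1\times S}/\sim)_{s\in S}$. -}

module Defs where

open import Level using (Level; _⊔_; 0ℓ) renaming (suc to lsuc)
open import Data.Product using (Σ; _×_; _,_; proj₁; proj₂)
open import Relation.Binary.Bundles using (Setoid)
open import Relation.Binary.PropositionalEquality as ≡ using (_≡_)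
open import Function.Bundles using (_↔_; Inverse; Bijection)
import Relation.Binary.Reasoning.Setoid as SetoidReasoning

-- Arities: the cardinals λ < κ.  Each arity code `n : Ar` denotes a set
-- `El n` (the cardinal, as a set of ordinals).  The arity 1 = {0} is
-- `𝟙` with unique element `⋆`; the product arity λ × μ (a set of size
-- < κ, used as an arity through a fixed bijection) is `n ⊗ m`, with the
-- fixed bijection `⊗-iso`.

record Arities : Set₁ where
  field
    Ar       : Set
    El       : Ar → Set
    𝟙        : Ar
    ⋆        : El 𝟙
    𝟙-unique : (x : El 𝟙) → x ≡ ⋆
    _⊗_      : Ar → Ar → Ar
    ⊗-iso    : ∀ n m → El (n ⊗ m) ↔ (El n × El m)

  pair : ∀ {n m} → El n → El m → El (n ⊗ m)
  pair {n} {m} i t = Inverse.from (⊗-iso n m) (i , t)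

  fst : ∀ {n m} → El (n ⊗ m) → El n
  fst {n} {m} k = proj₁ (Inverse.to (⊗-iso n m) k)

  snd : ∀ {n m} → El (n ⊗ m) → El m
  snd {n} {m} k = proj₂ (Inverse.to (⊗-iso n m) k)

record CloneStr (A : Arities) (c ℓ : Level) : Set (lsuc (c ⊔ ℓ)) where
  open Arities A
  infixr 9 _∘_
  infix 4 _≈_
  field
    Op  : Ar → Setoid c ℓ
    π   : ∀ {n} → El n → Setoid.Carrier (Op n)
    _∘_ : ∀ {m n} → Setoid.Carrier (Op m) → (El m → Setoid.Carrier (Op n))
          → Setoid.Carrier (Op n)

  ∣_∣ : Ar → Set c
  ∣ n ∣ = Setoid.Carrier (Op n)

  _≈_ : ∀ {n} → ∣ n ∣ → ∣ n ∣ → Set ℓ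
  _≈_ {n} = Setoid._≈_ (Op n)

  _⟪_⟫ : ∀ {n} → ∣ 𝟙 ∣ → ∣ n ∣ → ∣ n ∣
  f ⟪ g ⟫ = f ∘ (λ _ → g)

record IsClone {A : Arities} {c ℓ} (C : CloneStr A c ℓ) : Set (c ⊔ ℓ) where
  open Arities A
  open CloneStr C
  field
    ∘-cong : ∀ {m n} {f f′ : ∣ m ∣} {g g′ : El m → ∣ n ∣} →
             f ≈ f′ → (∀ i → g i ≈ g′ i) → f ∘ g ≈ f′ ∘ g′
    assoc  : ∀ {m n k} (f : ∣ m ∣) (g : El m → ∣ n ∣) (h : El n → ∣ k ∣) →
             (f ∘ g) ∘ h ≈ f ∘ (λ i → g i ∘ h)
    π-∘    : ∀ {m n} (i : El m) (g : El m → ∣ n ∣) → π i ∘ g ≈ g i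
    ∘-π    : ∀ {n} (f : ∣ n ∣) → f ∘ (λ i → π i) ≈ f

record Clone (A : Arities) (c ℓ : Level) : Set (lsuc (c ⊔ ℓ)) where
  field
    str     : CloneStr A c ℓ
    isClone : IsClone str
  open CloneStr str public
  open IsClone isClone public

record CloneIso {A : Arities} {c₁ ℓ₁ c₂ ℓ₂}
                (C : CloneStr A c₁ ℓ₁) (D : CloneStr A c₂ ℓ₂)
                : Set (c₁ ⊔ ℓ₁ ⊔ c₂ ⊔ ℓ₂) where
  open Arities A
  private
    module C = CloneStr C
    module D = CloneStr D
  field
    φ   : ∀ n → Bijection (C.Op n) (D.Op n)
    φ-π : ∀ {n} (i : El n) → Bijection.to (φ n) (C.π i) D.≈ D.π i
    φ-∘ : ∀ {m n} (f : C.∣ m ∣) (g : El m → C.∣ n ∣) →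
          Bijection.to (φ n) (f C.∘ g)
            D.≈ (Bijection.to (φ m) f D.∘ (λ i → Bijection.to (φ n) (g i)))

-- S-ary diagonal pairs.  `s₀` is the element 0 ∈ S (S a nonzero cardinal).

module _ {A : Arities} {c ℓ} (C : Clone A c ℓ) where
  open Arities A
  open Clone C

  record IsDiagonalPair (S : Ar) (s₀ : El S) (d : ∣ S ∣) (e : El S → ∣ 𝟙 ∣)
         : Set ℓ where
    field
      diag₁ : ∀ s → e s ⟪ d ⟫ ≈ e s ⟪ π s ⟫
      diag₂ : d ∘ (λ s → e s ⟪ π s ⟫) ≈ d
      diag₃ : d ∘ (λ _ → π s₀) ≈ π s₀

  Idempotent : ∣ 𝟙 ∣ → Set ℓ
  Idempotent f = f ⟪ f ⟫ ≈ f

  private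
    module _ {n : Ar} where
      open Setoid (Op n) public using () renaming
        (refl to ≈-refl; sym to ≈-sym; trans to ≈-trans)

    ⟪⟫-π : (f : ∣ 𝟙 ∣) → f ⟪ π ⋆ ⟫ ≈ f
    ⟪⟫-π f = ≈-trans (∘-cong ≈-refl (λ i → ≡.subst (λ x → π ⋆ ≈ π x)
                        (≡.sym (𝟙-unique i)) ≈-refl)) (∘-π f)

  diagonal-idempotent : ∀ {S s₀ d e} → IsDiagonalPair S s₀ d e →
                        ∀ s → Idempotent (e s)
  diagonal-idempotent {S} {s₀} {d} {e} dp s =
    begin
      e s ⟪ e s ⟫
    ≈⟨ ∘-cong ≈-refl (λ _ → ≈-sym (⟪⟫-π (e s))) ⟩
      e s ⟪ e s ⟪ u ⟫ ⟫
    ≈⟨ ∘-cong ≈-refl (λ _ → ∘-cong ≈-refl (λ _ → ≈-sym (π-∘ s U))) ⟩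
      e s ⟪ e s ⟪ π s ∘ U ⟫ ⟫
    ≈⟨ ∘-cong ≈-refl (λ _ → ≈-sym (assoc (e s) (λ _ → π s) U)) ⟩
      e s ⟪ (e s ⟪ π s ⟫) ∘ U ⟫
    ≈⟨ ≈-sym (assoc (e s) (λ _ → e s ⟪ π s ⟫) U) ⟩
      (e s ⟪ e s ⟪ π s ⟫ ⟫) ∘ U
    ≈⟨ ∘-cong (≈-sym key) (λ _ → ≈-refl) ⟩
      (e s ⟪ π s ⟫) ∘ U
    ≈⟨ assoc (e s) (λ _ → π s) U ⟩
      e s ⟪ π s ∘ U ⟫
    ≈⟨ ∘-cong ≈-refl (λ _ → π-∘ s U) ⟩
      e s ⟪ u ⟫
    ≈⟨ ⟪⟫-π (e s) ⟩
      e s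
    ∎
    where
    open SetoidReasoning (Op 𝟙)
    open IsDiagonalPair dp
    u : ∣ 𝟙 ∣
    u = π ⋆
    U : El S → ∣ 𝟙 ∣
    U _ = u
    ρ : El S → ∣ S ∣
    ρ t = e t ⟪ π t ⟫
    key : e s ⟪ π s ⟫ ≈ e s ⟪ e s ⟪ π s ⟫ ⟫
    key = ≈-trans (≈-sym (diag₁ s))
          (≈-trans (∘-cong ≈-refl (λ _ → ≈-sym diag₂))
          (≈-trans (≈-sym (assoc (e s) (λ _ → d) ρ))
          (≈-trans (∘-cong (diag₁ s) (λ _ → ≈-refl))
          (≈-trans (assoc (e s) (λ _ → π s) ρ)
                   (∘-cong ≈-refl (λ _ → π-∘ s ρ))))))

  -- The matrix product ⊠_{s∈S} e_s(C) of a family of idempotents.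
  -- Sort λ: tuples (f_s)_{s∈S}, f_s ∈ C_{λ×S}, e_s ∘ f_s = f_s, compared
  -- componentwise modulo ∼_λ (setoid instead of quotient).

  module _ (S : Ar) (e : El S → ∣ 𝟙 ∣) (idem : ∀ s → Idempotent (e s)) where

    ρ : ∀ n → El (n ⊗ S) → ∣ n ⊗ S ∣
    ρ n k = e (snd k) ⟪ π k ⟫

    Sim : ∀ n → ∣ n ⊗ S ∣ → ∣ n ⊗ S ∣ → Set ℓ
    Sim n f g = f ∘ ρ n ≈ g ∘ ρ n

    MPCarrier : Ar → Set (c ⊔ ℓ)
    MPCarrier n = (s : El S) → Σ ∣ n ⊗ S ∣ (λ f → e s ⟪ f ⟫ ≈ f)

    MPSetoid : Ar → Setoid (c ⊔ ℓ) ℓ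
    MPSetoid n = record
      { Carrier = MPCarrier n
      ; _≈_ = λ x y → ∀ s → Sim n (proj₁ (x s)) (proj₁ (y s))
      ; isEquivalence = record
        { refl  = λ s → ≈-refl
        ; sym   = λ p s → ≈-sym (p s)
        ; trans = λ p q s → ≈-trans (p s) (q s)
        }
      }

    private
      ⟪⟫-idem : ∀ {n} s (f : ∣ n ∣) → e s ⟪ e s ⟪ f ⟫ ⟫ ≈ e s ⟪ f ⟫
      ⟪⟫-idem s f = ≈-trans (≈-sym (assoc (e s) (λ _ → e s) (λ _ → f)))
                            (∘-cong (idem s) (λ _ → ≈-refl))

      ⟪⟫-∘ : ∀ {m n} s (f : ∣ m ∣) (g : El m → ∣ n ∣) →
             e s ⟪ f ⟫ ≈ f → e s ⟪ f ∘ g ⟫ ≈ f ∘ g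
      ⟪⟫-∘ s f g p = ≈-trans (≈-sym (assoc (e s) (λ _ → f) g))
                             (∘-cong p (λ _ → ≈-refl))

    MatrixProduct : CloneStr A (c ⊔ ℓ) ℓ
    MatrixProduct = record
      { Op  = MPSetoid
      ; π   = λ {n} i s → e s ⟪ π (pair i s) ⟫ , ⟪⟫-idem s (π (pair i s))
      ; _∘_ = λ {m} {n} F G s →
                proj₁ (F s) ∘ (λ k → proj₁ (G (fst k) (snd k)))
              , ⟪⟫-∘ s (proj₁ (F s)) _ (proj₂ (F s))
      }

-- Write Δᵢ := d ∘ (π_(i,t))_t ∈ C_{λ×S} and εₖ := e_t ∘ π_i ∈ C_λ for k = (i,t).
-- The isomorphism sends f to the row family (e_s ∘ f ∘ Δ)_s, and a row family
-- (f_s)_s back to d ∘ (f_s ∘ ε)_s.  Everything reduces to three consequences of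
-- the diagonal-pair axioms: d is idempotent on constant families, d ignores the
-- e_s applied to its arguments, and e_s ∘ d picks out the s-th argument; from them
-- Δᵢ ∘ ε = πᵢ and εₖ ∘ Δ = e_t ∘ π_k, which make the two maps mutually inverse.
module Submission where

open import Defs
open import Level using (Level; _⊔_)
open import Data.Product using (_,_; proj₁; proj₂)
open import Relation.Binary.Bundles using (Setoid)
open import Relation.Binary.PropositionalEquality as ≡ using (_≡_)
open import Function.Bundles using (Inverse)
open import Function.Properties.Inverse using (Inverse⇒Bijection)
import Relation.Binary.Reasoning.Setoid as SetoidReasoning

module PairProperties (A : Arities) where
  open Arities A

  fst-pair : ∀ {n m} (i : El n) (t : El m) → fst {n} {m} (pair i t) ≡ i
  fst-pair {n} {m} i t = ≡.cong proj₁ (Inverse.inverseˡ (⊗-iso n m) ≡.refl)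

  snd-pair : ∀ {n m} (i : El n) (t : El m) → snd {n} {m} (pair i t) ≡ t
  snd-pair {n} {m} i t = ≡.cong proj₂ (Inverse.inverseˡ (⊗-iso n m) ≡.refl)

  pair-fst-snd : ∀ {n m} (k : El (n ⊗ m)) → pair {n} {m} (fst k) (snd k) ≡ k
  pair-fst-snd {n} {m} k = Inverse.inverseʳ (⊗-iso n m) ≡.refl

module CloneProperties {A : Arities} {c ℓ} (C : Clone A c ℓ) where
  open Arities A
  open Clone C

  module _ {n : Ar} where
    open Setoid (Op n) public using () renaming
      (refl to ≈-refl; sym to ≈-sym; trans to ≈-trans; reflexive to ≡⇒≈)

  ∘-congʳ : ∀ {m n} {f f′ : ∣ m ∣} {g : El m → ∣ n ∣} → f ≈ f′ → f ∘ g ≈ f′ ∘ g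
  ∘-congʳ p = ∘-cong p (λ _ → ≈-refl)

  ∘-congˡ : ∀ {m n} {f : ∣ m ∣} {g g′ : El m → ∣ n ∣} →
            (∀ i → g i ≈ g′ i) → f ∘ g ≈ f ∘ g′
  ∘-congˡ = ∘-cong ≈-refl

  ⟪⟫-cong : ∀ {n} (u : ∣ 𝟙 ∣) {x y : ∣ n ∣} → x ≈ y → u ⟪ x ⟫ ≈ u ⟪ y ⟫
  ⟪⟫-cong u p = ∘-congˡ (λ _ → p)

  ⟪⟫-∘ : ∀ {m n} (u : ∣ 𝟙 ∣) (x : ∣ m ∣) (h : El m → ∣ n ∣) →
         u ⟪ x ⟫ ∘ h ≈ u ⟪ x ∘ h ⟫
  ⟪⟫-∘ u x h = assoc u (λ _ → x) h

  ⟪π⟫-∘ : ∀ {m n} (u : ∣ 𝟙 ∣) (k : El m) (h : El m → ∣ n ∣) →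
          u ⟪ π k ⟫ ∘ h ≈ u ⟪ h k ⟫
  ⟪π⟫-∘ u k h = ≈-trans (⟪⟫-∘ u (π k) h) (⟪⟫-cong u (π-∘ k h))

  ⟪⟫-idempotent : ∀ {n} {u : ∣ 𝟙 ∣} → Idempotent C u →
                  (x : ∣ n ∣) → u ⟪ u ⟪ x ⟫ ⟫ ≈ u ⟪ x ⟫
  ⟪⟫-idempotent {u = u} idem x =
    ≈-trans (≈-sym (assoc u (λ _ → u) (λ _ → x))) (∘-congʳ idem)

module DiagonalPairProperties
    {A : Arities} {c ℓ} (C : Clone A c ℓ)
    {S : Arities.Ar A} {s₀ : Arities.El A S}
    {d : Clone.∣_∣ C S} {e : Arities.El A S → Clone.∣_∣ C (Arities.𝟙 A)}
    (dp : IsDiagonalPair C S s₀ d e) where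

  open Arities A
  open Clone C
  open IsDiagonalPair dp
  open PairProperties A
  open CloneProperties C

  d-const : ∀ {n} (x : ∣ n ∣) → d ∘ (λ _ → x) ≈ x
  d-const {n} x = begin
    d ∘ (λ _ → x)                ≈⟨ ∘-congˡ (λ _ → ≈-sym (π-∘ s₀ (λ _ → x))) ⟩
    d ∘ (λ _ → π s₀ ∘ (λ _ → x)) ≈⟨ ≈-sym (assoc d (λ _ → π s₀) (λ _ → x)) ⟩
    (d ∘ (λ _ → π s₀)) ∘ (λ _ → x) ≈⟨ ∘-congʳ diag₃ ⟩
    π s₀ ∘ (λ _ → x)             ≈⟨ π-∘ s₀ (λ _ → x) ⟩
    x                            ∎
    where open SetoidReasoning (Op n)

  d-absorbs-e : ∀ {n} (x : El S → ∣ n ∣) → d ∘ (λ s → e s ⟪ x s ⟫) ≈ d ∘ x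
  d-absorbs-e {n} x = begin
    d ∘ (λ s → e s ⟪ x s ⟫)       ≈⟨ ∘-congˡ (λ s → ≈-sym (⟪π⟫-∘ (e s) s x)) ⟩
    d ∘ (λ s → e s ⟪ π s ⟫ ∘ x)   ≈⟨ ≈-sym (assoc d (λ s → e s ⟪ π s ⟫) x) ⟩
    (d ∘ (λ s → e s ⟪ π s ⟫)) ∘ x ≈⟨ ∘-congʳ diag₂ ⟩
    d ∘ x                         ∎
    where open SetoidReasoning (Op n)

  e-d : ∀ {n} s (x : El S → ∣ n ∣) → e s ⟪ d ∘ x ⟫ ≈ e s ⟪ x s ⟫
  e-d {n} s x = begin
    e s ⟪ d ∘ x ⟫   ≈⟨ ≈-sym (⟪⟫-∘ (e s) d x) ⟩
    e s ⟪ d ⟫ ∘ x   ≈⟨ ∘-congʳ (diag₁ s) ⟩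
    e s ⟪ π s ⟫ ∘ x ≈⟨ ⟪π⟫-∘ (e s) s x ⟩
    e s ⟪ x s ⟫     ∎
    where open SetoidReasoning (Op n)

  d-e-const : ∀ {n} (x : ∣ n ∣) → d ∘ (λ s → e s ⟪ x ⟫) ≈ x
  d-e-const x = ≈-trans (d-absorbs-e (λ _ → x)) (d-const x)

  Δ : ∀ n → El n → ∣ n ⊗ S ∣
  Δ n i = d ∘ (λ t → π (pair i t))

  spread : ∀ {m n} → (El m → ∣ n ∣) → El (m ⊗ S) → ∣ n ∣
  spread h k = e (snd k) ⟪ h (fst k) ⟫

  ε : ∀ n → El (n ⊗ S) → ∣ n ∣
  ε n = spread π

  Δ-∘-spread : ∀ {m n} (h : El m → ∣ n ∣) (i : El m) → Δ m i ∘ spread h ≈ h i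
  Δ-∘-spread {m} {n} h i = begin
    Δ m i ∘ spread h                    ≈⟨ assoc d _ (spread h) ⟩
    d ∘ (λ t → π (pair i t) ∘ spread h) ≈⟨ ∘-congˡ (λ t → π-∘ (pair i t) (spread h)) ⟩
    d ∘ (λ t → spread h (pair i t))     ≈⟨ ∘-congˡ (λ t → ≡⇒≈ (≡.cong₂ (λ s j → e s ⟪ h j ⟫)
                                                       (snd-pair i t) (fst-pair i t))) ⟩
    d ∘ (λ t → e t ⟪ h i ⟫)             ≈⟨ d-e-const (h i) ⟩
    h i                                 ∎
    where open SetoidReasoning (Op n)

  module Isomorphism (idem : ∀ s → Idempotent C (e s)) where

    M : CloneStr A (c ⊔ ℓ) ℓ
    M = MatrixProduct C S e idem
    module M = CloneStr M

    ρ̂ : ∀ n → El (n ⊗ S) → ∣ n ⊗ S ∣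
    ρ̂ = ρ C S e idem

    ε-∘-Δ : ∀ {n} (k : El (n ⊗ S)) → ε n k ∘ Δ n ≈ ρ̂ n k
    ε-∘-Δ {n} k = begin
      ε n k ∘ Δ n                            ≈⟨ ⟪π⟫-∘ (e (snd k)) (fst k) (Δ n) ⟩
      e (snd k) ⟪ Δ n (fst k) ⟫              ≈⟨ e-d (snd k) _ ⟩
      e (snd k) ⟪ π (pair (fst k) (snd k)) ⟫ ≈⟨ ⟪⟫-cong (e (snd k)) (≡⇒≈ (≡.cong π (pair-fst-snd k))) ⟩
      ρ̂ n k                                  ∎
      where open SetoidReasoning (Op (n ⊗ S))

    ρ̂-∘-ρ̂ : ∀ {n} (k : El (n ⊗ S)) → ρ̂ n k ∘ ρ̂ n ≈ ρ̂ n k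
    ρ̂-∘-ρ̂ {n} k = ≈-trans (⟪π⟫-∘ (e (snd k)) k (ρ̂ n)) (⟪⟫-idempotent (idem (snd k)) (π k))

    ∘-ε-respects-∼ : ∀ {n} {f g : ∣ n ⊗ S ∣} → Sim C S e idem n f g → f ∘ ε n ≈ g ∘ ε n
    ∘-ε-respects-∼ {n} {f} {g} f∼g = begin
      f ∘ ε n            ≈⟨ factor f ⟩
      (f ∘ ρ̂ n) ∘ πfst   ≈⟨ ∘-congʳ f∼g ⟩
      (g ∘ ρ̂ n) ∘ πfst   ≈⟨ ≈-sym (factor g) ⟩
      g ∘ ε n            ∎
      where
      open SetoidReasoning (Op n)
      πfst : El (n ⊗ S) → ∣ n ∣
      πfst k = π (fst k)
      factor : (h : ∣ n ⊗ S ∣) → h ∘ ε n ≈ (h ∘ ρ̂ n) ∘ πfst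
      factor h = ≈-sym (≈-trans (assoc h (ρ̂ n) πfst)
                                (∘-congˡ (λ k → ⟪π⟫-∘ (e (snd k)) k πfst)))

    toMatrix : ∀ n → ∣ n ∣ → M.∣ n ∣
    toMatrix n f s = e s ⟪ f ∘ Δ n ⟫ , ⟪⟫-idempotent (idem s) (f ∘ Δ n)

    fromMatrix : ∀ n → M.∣ n ∣ → ∣ n ∣
    fromMatrix n F = d ∘ (λ s → proj₁ (F s) ∘ ε n)

    toMatrix-cong : ∀ n {f g : ∣ n ∣} → f ≈ g → toMatrix n f M.≈ toMatrix n g
    toMatrix-cong n p s = ∘-congʳ (⟪⟫-cong (e s) (∘-congʳ p))

    fromMatrix-cong : ∀ n {F G : M.∣ n ∣} → F M.≈ G → fromMatrix n F ≈ fromMatrix n G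
    fromMatrix-cong n p = ∘-congˡ (λ s → ∘-ε-respects-∼ (p s))

    fromMatrix-toMatrix : ∀ n (f : ∣ n ∣) → fromMatrix n (toMatrix n f) ≈ f
    fromMatrix-toMatrix n f = begin
      d ∘ (λ s → e s ⟪ f ∘ Δ n ⟫ ∘ ε n)          ≈⟨ ∘-congˡ (λ s → ⟪⟫-∘ (e s) _ (ε n)) ⟩
      d ∘ (λ s → e s ⟪ (f ∘ Δ n) ∘ ε n ⟫)        ≈⟨ ∘-congˡ (λ s → ⟪⟫-cong (e s) (assoc f (Δ n) (ε n))) ⟩
      d ∘ (λ s → e s ⟪ f ∘ (λ i → Δ n i ∘ ε n) ⟫) ≈⟨ ∘-congˡ (λ s → ⟪⟫-cong (e s) (∘-congˡ (Δ-∘-spread π))) ⟩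
      d ∘ (λ s → e s ⟪ f ∘ (λ i → π i) ⟫)        ≈⟨ ∘-congˡ (λ s → ⟪⟫-cong (e s) (∘-π f)) ⟩
      d ∘ (λ s → e s ⟪ f ⟫)                      ≈⟨ d-e-const f ⟩
      f                                          ∎
      where open SetoidReasoning (Op n)

    toMatrix-fromMatrix : ∀ n (F : M.∣ n ∣) → toMatrix n (fromMatrix n F) M.≈ F
    toMatrix-fromMatrix n F s = begin
      e s ⟪ fromMatrix n F ∘ Δ n ⟫ ∘ ρ̂ n                      ≈⟨ ∘-congʳ (⟪⟫-cong (e s) (assoc d _ (Δ n))) ⟩
      e s ⟪ d ∘ (λ t → (proj₁ (F t) ∘ ε n) ∘ Δ n) ⟫ ∘ ρ̂ n     ≈⟨ ∘-congʳ (e-d s _) ⟩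
      e s ⟪ (f ∘ ε n) ∘ Δ n ⟫ ∘ ρ̂ n                           ≈⟨ ∘-congʳ (⟪⟫-cong (e s) (assoc f (ε n) (Δ n))) ⟩
      e s ⟪ f ∘ (λ k → ε n k ∘ Δ n) ⟫ ∘ ρ̂ n                   ≈⟨ ∘-congʳ (⟪⟫-cong (e s) (∘-congˡ ε-∘-Δ)) ⟩
      e s ⟪ f ∘ ρ̂ n ⟫ ∘ ρ̂ n                                   ≈⟨ ∘-congʳ (≈-sym (⟪⟫-∘ (e s) f (ρ̂ n))) ⟩
      (e s ⟪ f ⟫ ∘ ρ̂ n) ∘ ρ̂ n                                 ≈⟨ ∘-congʳ (∘-congʳ (proj₂ (F s))) ⟩
      (f ∘ ρ̂ n) ∘ ρ̂ n                                         ≈⟨ assoc f (ρ̂ n) (ρ̂ n) ⟩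
      f ∘ (λ k → ρ̂ n k ∘ ρ̂ n)                                 ≈⟨ ∘-congˡ ρ̂-∘-ρ̂ ⟩
      f ∘ ρ̂ n                                                 ∎
      where
      open SetoidReasoning (Op (n ⊗ S))
      f = proj₁ (F s)

    toMatrix-inverse : ∀ n → Inverse (Op n) (M.Op n)
    toMatrix-inverse n = record
      { to        = toMatrix n
      ; from      = fromMatrix n
      ; to-cong   = toMatrix-cong n
      ; from-cong = λ {F} {G} → fromMatrix-cong n {F} {G}
      ; inverse   = (λ {F} f≈F′ s → ≈-trans (toMatrix-cong n f≈F′ s) (toMatrix-fromMatrix n F s))
                  , (λ {f} {F} F≈f′ → ≈-trans (fromMatrix-cong n {F} {toMatrix n f} F≈f′) (fromMatrix-toMatrix n f))
      }

    toMatrix-π : ∀ {n} (i : El n) → toMatrix n (π i) M.≈ M.π i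
    toMatrix-π {n} i s = ∘-congʳ (≈-trans (⟪⟫-cong (e s) (π-∘ i (Δ n))) (e-d s _))

    toMatrix-∘ : ∀ {m n} (f : ∣ m ∣) (g : El m → ∣ n ∣) →
                 toMatrix n (f ∘ g) M.≈ (toMatrix m f M.∘ (λ i → toMatrix n (g i)))
    toMatrix-∘ {m} {n} f g s = ∘-congʳ (begin
      e s ⟪ (f ∘ g) ∘ Δ n ⟫                  ≈⟨ ⟪⟫-cong (e s) (assoc f g (Δ n)) ⟩
      e s ⟪ f ∘ (λ i → g i ∘ Δ n) ⟫          ≈⟨ ⟪⟫-cong (e s) (∘-congˡ (λ i → ≈-sym (Δ-∘-spread gΔ i))) ⟩
      e s ⟪ f ∘ (λ i → Δ m i ∘ spread gΔ) ⟫  ≈⟨ ⟪⟫-cong (e s) (≈-sym (assoc f (Δ m) (spread gΔ))) ⟩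
      e s ⟪ (f ∘ Δ m) ∘ spread gΔ ⟫          ≈⟨ ≈-sym (⟪⟫-∘ (e s) _ (spread gΔ)) ⟩
      e s ⟪ f ∘ Δ m ⟫ ∘ spread gΔ            ∎)
      where
      open SetoidReasoning (Op (n ⊗ S))
      gΔ : El m → ∣ n ⊗ S ∣
      gΔ i = g i ∘ Δ n

theorem4p5 : ∀ {c ℓ : Level} (A : Arities) (C : Clone A c ℓ)
    (S : Arities.Ar A) (s₀ : Arities.El A S)
    (d : Clone.∣_∣ C S) (e : Arities.El A S → Clone.∣_∣ C (Arities.𝟙 A))
    (dp : IsDiagonalPair C S s₀ d e) →
    CloneIso (Clone.str C) (MatrixProduct C S e (diagonal-idempotent C dp))
theorem4p5 A C S s₀ d e dp = record
  { φ   = λ n → Inverse⇒Bijection (toMatrix-inverse n)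
  ; φ-π = toMatrix-π
  ; φ-∘ = toMatrix-∘
  }
  where open DiagonalPairProperties.Isomorphism C dp (diagonal-idempotent C dp)
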